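{- For any $k\ge0$, the map $\psi_k:\mathbb{Z}_m\wr S_n\to\mathbb{Z}_{m+k}\wr S_n$ preserves witnesses: if $P$ is an admissible pinnacle set for $\mathbb{Z}_m\wr S_n$ and $w$ is a witness for $P$, then $\psi_k(w)$ is a witness for $\Psi_k(P)$ (i.e. $\operatorname{Pin}(\psi_k(w))=\Psi_k(P)$). In particular, $\psi_k(\omega_P)=\omega_{\Psi_k(P)}$.
   Context: For positive integers $M,n$, $[n]=\{1,\dots,n\}$, $\eta=e^{2\pi i/M}$; $\eta^a(x)$ denotes $\eta^a\cdot x$ ($0\le a\le M-1$, $x\in[n]$), $\mathbb{I}_n^M=\bigcup_{a=0}^{M-1}\{\eta^a(1),\dots,\eta^a(n)\}$, totally ordered by $\eta^a(x)\prec\eta^b(y)$ iff $a>b$, or $a=b$ and $x>y$. $\mathbb{Z}_M\wr S_n$ is the group of bijections $w$ of $\mathbb{I}_n^M$ with $w(\eta^i x)=\eta^i w(x)$ for $x\in[n]$, all $i$, written $w(n)\cdots w(1)$. $\operatorname{Pin}(w)=\{w(i):2\le i\le n-1,\ w(i+1)\prec w(i)\succ w(i-1)\}$; $P$ is admissible with witness $w$ if $\operatorname{Pin}(w)=P$. For admissible $P=\{\eta^{a_1}(p_1)\prec\dots\prec\eta^{a_d}(p_d)\}$ let $[n]\setminus\{p_1,\dots,p_d\}=\{v_1\prec\dots\prec v_{n-d}\}$ (so $v_1>\dots>v_{n-d}$); the canonical witness is $\omega_P=\eta^{M-1}(v_1)\,\eta^{a_1}(p_1)\,\eta^{M-1}(v_2)\cdots\eta^{M-1}(v_d)\,\eta^{a_d}(p_d)\,\eta^{M-1}(v_{d+1})\cdots\eta^{M-1}(v_{n-d})$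 in one-line notation. Fix $m\ge1$, $k\ge0$, $\xi=e^{2\pi i/m}$, $\zeta=e^{2\pi i/(m+k)}$. $\Psi_k$ sends a subset $\{\xi^{a_j}(x_j)\}$ of $\mathbb{I}_n^m$ to $\{\zeta^{a_j+k}(x_j)\}\subseteq\mathbb{I}_n^{m+k}$, and $\psi_k(w)\in\mathbb{Z}_{m+k}\wr S_n$ is defined by $\psi_k(w)(i)=\zeta^{a+k}(x)$ whenever $w(i)=\xi^a(x)$, $i\in[n]$. -}

module Defs where

open import Data.Nat using (ℕ; zero; suc; _+_; _<_; _>_)
open import Data.Nat.Properties using (+-comm)
open import Data.Fin using (Fin; toℕ; fromℕ; _↑ʳ_; cast)
open import Data.Product using (_×_; _,_; Σ; ∃; ∃-syntax; proj₁; proj₂)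
open import Data.Sum using (_⊎_)
open import Data.List using (List; []; _∷_; _++_; map; filter; length; upTo; downFrom)
open import Data.List.Membership.Propositional using (_∈_)
open import Data.List.Membership.DecPropositional (Data.Nat._≟_) using (_∈?_)
open import Data.List.Relation.Binary.Permutation.Propositional using (_↭_)
open import Data.List.Relation.Unary.Linked using (Linked)
open import Relation.Nullary using (¬?)
open import Relation.Binary.PropositionalEquality using (_≡_)

record Letter (M : ℕ) : Set where
  constructor col
  field
    colour : Fin M
    val    : ℕ
open Letter public

_≺_ : ∀ {M} → Letter M → Letter M → Set
col a x ≺ col b y = (toℕ a > toℕ b) ⊎ ((a ≡ b) × (x > y))

[_] : ℕ → List ℕ
[ n ] = map suc (upTo n)

-- An element w of Z_M ≀ S_n, given by its one-line notation written
-- w(n) w(n-1) ... w(1) (head of the list is w(n)).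
IsColPerm : ∀ {M} → ℕ → List (Letter M) → Set
IsColPerm n w = map val w ↭ [ n ]

_∈Pin_ : ∀ {M} → Letter M → List (Letter M) → Set
_∈Pin_ {M} z w = Σ (List (Letter M)) λ l₁ → Σ (Letter M) λ x → Σ (Letter M) λ y →
  Σ (List (Letter M)) λ l₂ → (w ≡ l₁ ++ x ∷ z ∷ y ∷ l₂) × (x ≺ z) × (y ≺ z)

Witness : ∀ {M} → List (Letter M) → List (Letter M) → Set
Witness {M} w P = (z : Letter M) → ((z ∈Pin w) → (z ∈ P)) × ((z ∈ P) → (z ∈Pin w))

AdmissibleSorted : ∀ {M} → ℕ → List (Letter M) → Set
AdmissibleSorted {M} n P =
  Linked _≺_ P × (∃[ w ] (IsColPerm n w × Witness w P))

shiftLetter : ∀ {m} (k : ℕ) → Letter m → Letter (m + k)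
shiftLetter {m} k (col a x) = col (cast (+-comm k m) (k ↑ʳ a)) x

Ψ : ∀ {m} (k : ℕ) → List (Letter m) → List (Letter (m + k))
Ψ k P = map (shiftLetter k) P

ψ : ∀ {m} (k : ℕ) → List (Letter m) → List (Letter (m + k))
ψ k w = map (shiftLetter k) w

interleave : ∀ {A : Set} → List A → List A → List A
interleave (v ∷ vs) (p ∷ ps) = v ∷ p ∷ interleave vs ps
interleave vs [] = vs
interleave [] ps = ps

ω : ∀ {M'} (n : ℕ) → List (Letter (suc M')) → List (Letter (suc M'))
ω {M'} n P = interleave (map (λ v → col (fromℕ M') v) vs) P
  where
  vs : List ℕ
  vs = filter (λ v → ¬? (v ∈? map val P)) (map suc (downFrom n))

Letters : ℕ → Set
Letters M = List (Letter M)

{-# OPTIONS --safe #-}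
-- ψ_k adds k to every colour and keeps values, so it is strictly monotone and
-- order-reflecting for ≺.  Pinnacles are defined by two ≺-comparisons with the
-- neighbours, hence ψ_k maps the pinnacles of w exactly onto those of ψ_k(w).
-- It also sends the top colour m-1 to the top colour m+k-1 and does not change
-- the set of pinnacle values, so it commutes with the construction of ω_P.
module Submission where

open import Defs
open import Data.Nat using (ℕ; suc; _+_)
open import Data.Product using (_×_)
open import Relation.Binary.PropositionalEquality using (_≡_)

open import Data.Nat using (_>_; _≟_)
open import Data.Nat.Properties using (+-comm; +-cancelˡ-≡; +-cancelˡ-<; +-monoʳ-<)
open import Data.Fin using (toℕ; fromℕ; _↑ʳ_)
open import Data.Fin.Properties using (toℕ-injective; toℕ-cast; toℕ-↑ʳ; toℕ-fromℕ)
open import Data.Product using (_,_; ∃-syntax; proj₁; proj₂)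
open import Data.Sum using (inj₁; inj₂)
open import Data.List using (List; []; _∷_; _++_; map; filter; downFrom)
open import Data.List.Properties using (map-++; map-∘; map-cong; ∷-injective)
open import Data.List.Membership.Propositional using (_∈_)
open import Data.List.Membership.Propositional.Properties using (∈-map⁺; ∈-map⁻)
open import Data.List.Membership.DecPropositional _≟_ using (_∈?_)
open import Relation.Nullary using (¬?)
open import Relation.Binary.PropositionalEquality
  using (refl; sym; trans; cong; subst₂; module ≡-Reasoning)

map-≡-++⁻ : ∀ {A B : Set} (f : A → B) (xs : List A) (ys zs : List B) →
  map f xs ≡ ys ++ zs →
  ∃[ xs₁ ] ∃[ xs₂ ] (xs ≡ xs₁ ++ xs₂) × (map f xs₁ ≡ ys) × (map f xs₂ ≡ zs)
map-≡-++⁻ f xs       []       zs eq = [] , xs , refl , refl , eq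
map-≡-++⁻ f []       (y ∷ ys) zs ()
map-≡-++⁻ f (x ∷ xs) (y ∷ ys) zs eq with ∷-injective eq
... | refl , eq′ with map-≡-++⁻ f xs ys zs eq′
...   | xs₁ , xs₂ , refl , refl , refl = x ∷ xs₁ , xs₂ , refl , refl , refl

map-interleave : ∀ {A B : Set} (f : A → B) (xs ys : List A) →
  map f (interleave xs ys) ≡ interleave (map f xs) (map f ys)
map-interleave f (x ∷ xs) (y ∷ ys) = cong (λ t → f x ∷ f y ∷ t) (map-interleave f xs ys)
map-interleave f []       []       = refl
map-interleave f (x ∷ xs) []       = refl
map-interleave f []       (y ∷ ys) = refl

module _ {M N : ℕ} {f : Letter M → Letter N}
         (f-mono : ∀ {x y} → x ≺ y → f x ≺ f y)
         (f-reflects : ∀ {x y} → f x ≺ f y → x ≺ y) where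

  map-∈Pin : ∀ {z w} → z ∈Pin w → f z ∈Pin map f w
  map-∈Pin {z} (l₁ , x , y , l₂ , refl , x≺z , y≺z) =
    map f l₁ , f x , f y , map f l₂ , map-++ f l₁ (x ∷ z ∷ y ∷ l₂) , f-mono x≺z , f-mono y≺z

  map-∈Pin⁻ : ∀ {z} w → z ∈Pin map f w → ∃[ z′ ] (f z′ ≡ z) × (z′ ∈Pin w)
  map-∈Pin⁻ w (l₁ , _ , _ , l₂ , eq , x≺z , y≺z)
    with map-≡-++⁻ f w l₁ _ eq
  ... | w₁ , x′ ∷ z′ ∷ y′ ∷ w₂ , refl , _ , refl =
    z′ , refl , w₁ , x′ , y′ , w₂ , refl , f-reflects x≺z , f-reflects y≺z

  map-Witness : ∀ {w P} → Witness w P → Witness (map f w) (map f P)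
  map-Witness {w} {P} W z = pin⇒∈ , ∈⇒pin
    where
    pin⇒∈ : z ∈Pin map f w → z ∈ map f P
    pin⇒∈ z∈Pin with map-∈Pin⁻ w z∈Pin
    ... | z′ , refl , z′∈Pin = ∈-map⁺ f (proj₁ (W z′) z′∈Pin)

    ∈⇒pin : z ∈ map f P → z ∈Pin map f w
    ∈⇒pin z∈ with ∈-map⁻ f z∈
    ... | z′ , z′∈P , refl = map-∈Pin (proj₂ (W z′) z′∈P)

module _ {m : ℕ} (k : ℕ) where

  toℕ-colour-shiftLetter : ∀ (l : Letter m) →
    toℕ (colour (shiftLetter k l)) ≡ k + toℕ (colour l)
  toℕ-colour-shiftLetter (col a _) = trans (toℕ-cast (+-comm k m) (k ↑ʳ a)) (toℕ-↑ʳ k a)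

  colour-shiftLetter-injective : ∀ {l l′ : Letter m} →
    colour (shiftLetter k l) ≡ colour (shiftLetter k l′) → colour l ≡ colour l′
  colour-shiftLetter-injective {l} {l′} eq = toℕ-injective (+-cancelˡ-≡ k _ _ (begin
    k + toℕ (colour l)             ≡⟨ toℕ-colour-shiftLetter l ⟨
    toℕ (colour (shiftLetter k l))  ≡⟨ cong toℕ eq ⟩
    toℕ (colour (shiftLetter k l′)) ≡⟨ toℕ-colour-shiftLetter l′ ⟩
    k + toℕ (colour l′)            ∎))
    where open ≡-Reasoning

  shiftLetter-mono : ∀ {x y : Letter m} → x ≺ y → shiftLetter k x ≺ shiftLetter k y
  shiftLetter-mono {x} {y} (inj₁ a>b) = inj₁ (subst₂ _>_
    (sym (toℕ-colour-shiftLetter x)) (sym (toℕ-colour-shiftLetter y)) (+-monoʳ-< k a>b))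
  shiftLetter-mono (inj₂ (refl , u>v)) = inj₂ (refl , u>v)

  shiftLetter-reflects : ∀ {x y : Letter m} → shiftLetter k x ≺ shiftLetter k y → x ≺ y
  shiftLetter-reflects {x} {y} (inj₁ a>b) = inj₁ (+-cancelˡ-< k _ _ (subst₂ _>_
    (toℕ-colour-shiftLetter x) (toℕ-colour-shiftLetter y) a>b))
  shiftLetter-reflects {x} {y} (inj₂ (eq , u>v)) =
    inj₂ (colour-shiftLetter-injective {x} {y} eq , u>v)

  ψ-Witness : ∀ {w P : Letters m} → Witness w P → Witness (ψ k w) (Ψ k P)
  ψ-Witness = map-Witness shiftLetter-mono shiftLetter-reflects

  map-val-Ψ : ∀ (P : Letters m) → map val (Ψ k P) ≡ map val P
  map-val-Ψ P = sym (map-∘ P)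

shiftLetter-top : ∀ {m′} k v → shiftLetter k (col (fromℕ m′) v) ≡ col (fromℕ (m′ + k)) v
shiftLetter-top {m′} k v = cong (λ c → col c v) (toℕ-injective (begin
  toℕ (colour (shiftLetter k (col (fromℕ m′) v))) ≡⟨ toℕ-colour-shiftLetter k (col (fromℕ m′) v) ⟩
  k + toℕ (fromℕ m′)                              ≡⟨ cong (k +_) (toℕ-fromℕ m′) ⟩
  k + m′                                          ≡⟨ +-comm k m′ ⟩
  m′ + k                                          ≡⟨ toℕ-fromℕ (m′ + k) ⟨
  toℕ (fromℕ (m′ + k))                            ∎))
  where open ≡-Reasoning

ψ-ω : ∀ {m′} k n (P : Letters (suc m′)) → ψ k (ω n P) ≡ ω n (Ψ k P)
ψ-ω {m′} k n P = begin
  map (shiftLetter k) (interleave (map (top m′) (nonPins P)) P)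
    ≡⟨ map-interleave (shiftLetter k) (map (top m′) (nonPins P)) P ⟩
  interleave (map (shiftLetter k) (map (top m′) (nonPins P))) (Ψ k P)
    ≡⟨ cong (λ vs → interleave vs (Ψ k P)) (shift-tops (nonPins P)) ⟩
  interleave (map (top (m′ + k)) (nonPins P)) (Ψ k P)
    ≡⟨ cong (λ vs → interleave (map (top (m′ + k)) vs) (Ψ k P))
         (cong nonPinsOf (sym (map-val-Ψ k P))) ⟩
  ω n (Ψ k P) ∎
  where
  open ≡-Reasoning

  top : ∀ M′ → ℕ → Letter (suc M′)
  top M′ v = col (fromℕ M′) v

  -- the values v₁ > ⋯ > v_{n-d}, computed exactly as in the where clause of ω
  nonPinsOf : List ℕ → List ℕ
  nonPinsOf L = filter (λ v → ¬? (v ∈? L)) (map suc (downFrom n))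

  nonPins : Letters (suc m′) → List ℕ
  nonPins Q = nonPinsOf (map val Q)

  shift-tops : ∀ vs → map (shiftLetter k) (map (top m′) vs) ≡ map (top (m′ + k)) vs
  shift-tops vs = trans (sym (map-∘ vs)) (map-cong (shiftLetter-top k) vs)

mainTheorem12 : (m' k n : ℕ) →
    ((w : Letters (suc m')) → IsColPerm n w → (P : Letters (suc m')) →
      Witness w P → Witness (ψ k w) (Ψ k P))
    × ((P : Letters (suc m')) → AdmissibleSorted n P →
      ψ k (ω n P) ≡ ω n (Ψ k P))
mainTheorem12 m' k n = (λ w _ P → ψ-Witness k) , (λ P _ → ψ-ω k n P)
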